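{- Let $m\ge 2$ be an integer, let $S\subset\mathbb{R}^d$ be an $m$-point convex set, and let $p,q\in S$. Then $S\setminus pq$ is $(2m-1)$-point convex, where $pq=\mathrm{conv}\{p,q\}$.
   Context: For $x,y\in\mathbb{R}^d$, $xy$ denotes the closed line-segment $\mathrm{conv}\{x,y\}$. For an integer $k\ge 2$, a set $S\subset\mathbb{R}^d$ is $k$-point convex if for every $k$ distinct points of $S$, at least one of the line-segments joining two of them lies in $S$. -}

module Defs where

open import Level using (0ℓ)
open import Data.Nat using (ℕ)
open import Data.Fin using (Fin)
open import Data.Product using (Σ; ∃; _×_; ∃-syntax)
open import Relation.Nullary using (¬_)
open import Relation.Unary using (Pred)
open import Relation.Binary.PropositionalEquality using (_≡_; _≢_)
open import Relation.Binary.Structures using (IsTotalOrder)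
open import Algebra.Structures using (IsCommutativeRing)

-- The real numbers, axiomatised as a complete ordered field
-- (any two such are isomorphic, so quantifying over all of them
-- is the same as speaking about ℝ).
record RealField : Set₁ where
  infixl 6 _+_
  infixl 7 _*_
  infix 4 _≤_
  field
    Carrier : Set
    _+_ _*_ : Carrier → Carrier → Carrier
    -_      : Carrier → Carrier
    0# 1#   : Carrier
    _≤_     : Carrier → Carrier → Set
    isCommutativeRing : IsCommutativeRing _≡_ _+_ _*_ -_ 0# 1#
    0≢1     : 0# ≢ 1#
    inverse : ∀ x → x ≢ 0# → ∃[ y ] (x * y ≡ 1#)
    isTotalOrder : IsTotalOrder _≡_ _≤_
    +-mono-≤ : ∀ {x y} z → x ≤ y → x + z ≤ y + z
    *-nonneg : ∀ {x y} → 0# ≤ x → 0# ≤ y → 0# ≤ x * y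
    lub : (A : Pred Carrier 0ℓ) → ∃ A → (∃[ b ] (∀ a → A a → a ≤ b)) →
          ∃[ s ] ((∀ a → A a → a ≤ s) × (∀ b → (∀ a → A a → a ≤ b) → s ≤ b))

module _ (ℝ : RealField) where
  open RealField ℝ

  Point : ℕ → Set
  Point d = Fin d → Carrier

  _≐_ : ∀ {d} → Point d → Point d → Set
  x ≐ y = ∀ c → x c ≡ y c

  Segment : ∀ {d} → Point d → Point d → Pred (Point d) 0ℓ
  Segment x y z = ∃[ t ] ((0# ≤ t) × (t ≤ 1#) ×
                    (∀ c → z c ≡ (1# + - t) * x c + t * y c))

  PointConvex : ∀ {d} → ℕ → Pred (Point d) 0ℓ → Set
  PointConvex {d} k S =
    (v : Fin k → Point d) → (∀ i → S (v i)) →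
    (∀ i j → v i ≐ v j → i ≡ j) →
    ∃[ i ] ∃[ j ] ((i ≢ j) × (∀ z → Segment (v i) (v j) z → S z))

  RemoveSeg : ∀ {d} → Pred (Point d) 0ℓ → Point d → Point d → Pred (Point d) 0ℓ
  RemoveSeg S p q z = S z × ¬ Segment p q z

-- Order ℝᵈ lexicographically by (transversal part, coordinate along pq), where the transversal
-- part is a linear map killing exactly the direction u = q − p.  This is a total order compatible
-- with positive combinations, and a point lies between p and q in it only if it lies on the
-- segment pq.  So every point off pq is either ahead of p, and then beyond q, or behind p; a
-- segment joining two points ahead of q (or two points behind p) stays ahead of q (behind p) and
-- misses pq.  Among 2m − 1 points of S ∖ pq, m are on the same side; m-point convexity of S joins
-- two of them by a segment inside S, which then lies in S ∖ pq.

module Submission where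

open import Defs
open import Level using (0ℓ)
open import Algebra.Bundles using (CommutativeRing)
open import Algebra.Solver.Ring.AlmostCommutativeRing using (fromCommutativeRing; _-Raw-AlmostCommutative⟶_)
open import Axiom.ExcludedMiddle using (ExcludedMiddle)
open import Data.Empty using (⊥; ⊥-elim)
open import Data.Fin using (Fin; zero; suc; lift)
import Data.Fin.Properties as Fin
open import Data.Integer as ℤ using (ℤ; -[1+_]; +[1+_]; _⊖_) renaming (+_ to pos)
import Data.Integer.Properties as ℤ
open import Data.Maybe using (Maybe; just; nothing)
open import Data.Nat as ℕ using (ℕ; zero; suc)
import Data.Nat.Properties as ℕ
open import Data.Product using (∃-syntax; _×_; _,_; proj₁; proj₂)
open import Data.Sign as Sign using (Sign)
open import Data.Sum as Sum using (_⊎_; inj₁; inj₂; [_,_]′)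
open import Data.Vec.Functional using (head; tail)
open import Function using (id; _∘_)
open import Function.Definitions using (Injective)
open import Relation.Binary.PropositionalEquality
open import Relation.Binary.Structures using (IsTotalOrder)
open import Relation.Nullary using (¬_; yes; no)
open import Relation.Nullary.Decidable using (toSum)
open import Relation.Unary using (Pred; _⊆_; _⊆′_; _∪_; ∁)

record AtLeast {ℓ n} (a : ℕ) (P : Pred (Fin n) ℓ) : Set ℓ where
  constructor pick
  field
    index           : Fin a → Fin n
    index-injective : Injective _≡_ _≡_ index
    index∈P         : ∀ i → P (index i)

module _ {ℓ n} {P : Pred (Fin n) ℓ} where

  atLeast-zero : AtLeast 0 P
  atLeast-zero = pick (λ ()) (λ { {()} }) (λ ())

module _ {ℓ n} {P : Pred (Fin (suc n)) ℓ} {a : ℕ} where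

  atLeast-suc : AtLeast a (P ∘ suc) → AtLeast a P
  atLeast-suc (pick e e-injective e∈P) = pick (suc ∘ e) (e-injective ∘ Fin.suc-injective) e∈P

  atLeast-cons : P zero → AtLeast a (P ∘ suc) → AtLeast (suc a) P
  atLeast-cons P₀ (pick e e-injective e∈P) = pick (lift 1 e) (Fin.lift-injective e e-injective 1) λ where
    zero    → P₀
    (suc i) → e∈P i

pigeonhole : ∀ {ℓ n} {P Q : Pred (Fin n) ℓ} → (∀ i → P i ⊎ Q i) →
             ∀ a b → a ℕ.+ b ℕ.≤ suc n → AtLeast a P ⊎ AtLeast b Q
pigeonhole colour zero    b    _ = inj₁ atLeast-zero
pigeonhole colour (suc a) zero _ = inj₂ atLeast-zero
pigeonhole {n = zero}  colour (suc a) (suc b) (ℕ.s≤s a+1+b≤0) with () ← ℕ.m+n≤o⇒n≤o a a+1+b≤0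
pigeonhole {n = suc n} colour (suc a) (suc b) (ℕ.s≤s a+1+b≤1+n) with colour zero
... | inj₁ P₀ = Sum.map (atLeast-cons P₀) atLeast-suc (pigeonhole (colour ∘ suc) a (suc b) a+1+b≤1+n)
... | inj₂ Q₀ = Sum.map atLeast-suc (atLeast-cons Q₀)
                  (pigeonhole (colour ∘ suc) (suc a) b (subst (ℕ._≤ suc n) (ℕ.+-suc a b) a+1+b≤1+n))

module _ (ℝ : RealField) where

  AvoidsSegment : ∀ {d} → Point ℝ d → Point ℝ d → Pred (Point ℝ d) 0ℓ → Set
  AvoidsSegment p q A = ∀ {x y} → A x → A y → ¬ Segment ℝ p q x → ¬ Segment ℝ p q y →
                        Segment ℝ x y ⊆ ∁ (Segment ℝ p q)

  removeSeg-pointConvex : ∀ {d} m {S A B : Pred (Point ℝ d) 0ℓ} {p q} → PointConvex ℝ m S →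
                          RemoveSeg ℝ S p q ⊆ A ∪ B → AvoidsSegment p q A → AvoidsSegment p q B →
                          PointConvex ℝ (2 ℕ.* m ℕ.∸ 1) (RemoveSeg ℝ S p q)
  removeSeg-pointConvex m {S} {p = p} {q} S-convex cover A-avoids B-avoids v v∈ v-distinct =
    [ joinWithin A-avoids , joinWithin B-avoids ]′ (pigeonhole (λ i → cover (v∈ i)) m m m+m≤1+[2m∸1])
    where
    m+m≤1+[2m∸1] : m ℕ.+ m ℕ.≤ suc (2 ℕ.* m ℕ.∸ 1)
    m+m≤1+[2m∸1] = subst (ℕ._≤ suc (2 ℕ.* m ℕ.∸ 1)) (cong (m ℕ.+_) (ℕ.+-identityʳ m))
                         (ℕ.m≤n+m∸n (2 ℕ.* m) 1)

    joinWithin : ∀ {C} → AvoidsSegment p q C → AtLeast m (C ∘ v) →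
                 ∃[ i ] ∃[ j ] (i ≢ j × Segment ℝ (v i) (v j) ⊆′ RemoveSeg ℝ S p q)
    joinWithin C-avoids (pick e e-injective e∈C)
      with S-convex (v ∘ e) (proj₁ ∘ v∈ ∘ e) (λ i j → e-injective ∘ v-distinct (e i) (e j))
    ... | i , j , i≢j , eᵢeⱼ⊆S =
      e i , e j , i≢j ∘ e-injective ,
      λ z z∈eᵢeⱼ → eᵢeⱼ⊆S z z∈eᵢeⱼ ,
                   C-avoids (e∈C i) (e∈C j) (proj₂ (v∈ (e i))) (proj₂ (v∈ (e j))) z∈eᵢeⱼ

-- The carrier is abstract, so the solver's coefficients must compute elsewhere: they live in ℤ.
module RealSolver (ℝ : RealField) where
  open RealField ℝ

  commutativeRing : CommutativeRing 0ℓ 0ℓ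
  commutativeRing = record { isCommutativeRing = isCommutativeRing }

  private
    open CommutativeRing commutativeRing
      using ( ring; semiring; +-commutativeSemigroup; *-commutativeSemigroup
            ; +-identityˡ; +-identityʳ; +-comm; *-identityˡ; *-comm; zeroʳ; -‿inverseʳ )
    open import Algebra.Properties.Ring ring using (-‿involutive; -0#≈0#; -‿+-comm; -1*x≈-x)
    open import Algebra.Properties.CommutativeSemigroup +-commutativeSemigroup
      using () renaming (interchange to +-interchange)
    open import Algebra.Properties.CommutativeSemigroup *-commutativeSemigroup
      using () renaming (interchange to *-interchange)
    -- the optimised multiple: 0 · 1# and 1 · 1# reduce to 0# and 1#, hence so do the constants :0 and :1
    open import Algebra.Properties.Semiring.Mult.TCOptimised semiring
      using (1+×; ×-homo-+; ×1-homo-*) renaming (_×_ to _·_)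
    open ≡-Reasoning

    fromℤ : ℤ → Carrier
    fromℤ (pos n)    = n · 1#
    fromℤ -[1+ n ]   = - (suc n · 1#)

    fromℤ-neg : ∀ i → fromℤ (ℤ.- i) ≡ - fromℤ i
    fromℤ-neg (pos zero) = sym -0#≈0#
    fromℤ-neg +[1+ n ]   = refl
    fromℤ-neg -[1+ n ]   = sym (-‿involutive _)

    fromℤ-⊖ : ∀ m n → fromℤ (m ⊖ n) ≡ m · 1# + - (n · 1#)
    fromℤ-⊖ m zero = begin
      fromℤ (m ⊖ 0)  ≡⟨ cong fromℤ (ℤ.⊖-≥ {m} {0} ℕ.z≤n) ⟩
      m · 1#         ≡⟨ +-identityʳ _ ⟨
      m · 1# + 0#    ≡⟨ cong ((m · 1#) +_) -0#≈0# ⟨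
      m · 1# + - 0#  ∎
    fromℤ-⊖ zero (suc n) = begin
      fromℤ (0 ⊖ suc n)    ≡⟨ cong fromℤ (ℤ.⊖-≤ {0} {suc n} ℕ.z≤n) ⟩
      - (suc n · 1#)       ≡⟨ +-identityˡ _ ⟨
      0# + - (suc n · 1#)  ∎
    fromℤ-⊖ (suc m) (suc n) = begin
      fromℤ (suc m ⊖ suc n)        ≡⟨ cong fromℤ (ℤ.[1+m]⊖[1+n]≡m⊖n m n) ⟩
      fromℤ (m ⊖ n)                ≡⟨ fromℤ-⊖ m n ⟩
      x + - y                      ≡⟨ +-identityˡ _ ⟨
      0# + (x + - y)               ≡⟨ cong (_+ (x + - y)) (-‿inverseʳ 1#) ⟨
      (1# + - 1#) + (x + - y)      ≡⟨ +-interchange 1# (- 1#) x (- y) ⟩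
      (1# + x) + (- 1# + - y)      ≡⟨ cong ((1# + x) +_) (-‿+-comm 1# y) ⟩
      (1# + x) + - (1# + y)        ≡⟨ cong₂ (λ a b → a + - b) (1+× m 1#) (1+× n 1#) ⟨
      suc m · 1# + - (suc n · 1#)  ∎
      where x = m · 1#; y = n · 1#

    fromℤ-+ : ∀ i j → fromℤ (i ℤ.+ j) ≡ fromℤ i + fromℤ j
    fromℤ-+ (pos m)  (pos n)  = ×-homo-+ 1# m n
    fromℤ-+ (pos m)  -[1+ n ] = fromℤ-⊖ m (suc n)
    fromℤ-+ -[1+ m ] (pos n)  = trans (fromℤ-⊖ n (suc m)) (+-comm _ _)
    fromℤ-+ -[1+ m ] -[1+ n ] = begin
      - (suc (suc (m ℕ.+ n)) · 1#)     ≡⟨ cong (λ k → - (k · 1#)) (ℕ.+-suc (suc m) n) ⟨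
      - ((suc m ℕ.+ suc n) · 1#)       ≡⟨ cong -_ (×-homo-+ 1# (suc m) (suc n)) ⟩
      - (suc m · 1# + suc n · 1#)      ≡⟨ -‿+-comm _ _ ⟨
      - (suc m · 1#) + - (suc n · 1#)  ∎

    σ : Sign → Carrier
    σ Sign.+ = 1#
    σ Sign.- = - 1#

    σ-* : ∀ s t → σ (s Sign.* t) ≡ σ s * σ t
    σ-* Sign.+ t      = sym (*-identityˡ _)
    σ-* Sign.- Sign.+ = sym (trans (*-comm _ _) (*-identityˡ _))
    σ-* Sign.- Sign.- = sym (trans (-1*x≈-x (- 1#)) (-‿involutive 1#))

    fromℤ-◃ : ∀ s n → fromℤ (s ℤ.◃ n) ≡ σ s * (n · 1#)
    fromℤ-◃ Sign.+ zero    = sym (zeroʳ _)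
    fromℤ-◃ Sign.- zero    = sym (zeroʳ _)
    fromℤ-◃ Sign.+ (suc n) = sym (*-identityˡ _)
    fromℤ-◃ Sign.- (suc n) = sym (-1*x≈-x _)

    fromℤ-sign◃∣∣ : ∀ i → σ (ℤ.sign i) * (ℤ.∣ i ∣ · 1#) ≡ fromℤ i
    fromℤ-sign◃∣∣ i = trans (sym (fromℤ-◃ (ℤ.sign i) ℤ.∣ i ∣)) (cong fromℤ (ℤ.◃-inverse i))

    fromℤ-* : ∀ i j → fromℤ (i ℤ.* j) ≡ fromℤ i * fromℤ j
    fromℤ-* i j = begin
      fromℤ ((sᵢ Sign.* sⱼ) ℤ.◃ (nᵢ ℕ.* nⱼ))    ≡⟨ fromℤ-◃ (sᵢ Sign.* sⱼ) (nᵢ ℕ.* nⱼ) ⟩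
      σ (sᵢ Sign.* sⱼ) * ((nᵢ ℕ.* nⱼ) · 1#)     ≡⟨ cong₂ _*_ (σ-* sᵢ sⱼ) (×1-homo-* nᵢ nⱼ) ⟩
      (σ sᵢ * σ sⱼ) * (nᵢ · 1# * nⱼ · 1#)       ≡⟨ *-interchange _ _ _ _ ⟩
      (σ sᵢ * nᵢ · 1#) * (σ sⱼ * nⱼ · 1#)       ≡⟨ cong₂ _*_ (fromℤ-sign◃∣∣ i) (fromℤ-sign◃∣∣ j) ⟩
      fromℤ i * fromℤ j                         ∎
      where sᵢ = ℤ.sign i; sⱼ = ℤ.sign j; nᵢ = ℤ.∣ i ∣; nⱼ = ℤ.∣ j ∣

    homomorphism : ℤ.+-*-rawRing -Raw-AlmostCommutative⟶ fromCommutativeRing commutativeRing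
    homomorphism = record
      { ⟦_⟧ = fromℤ ; +-homo = fromℤ-+ ; *-homo = fromℤ-* ; -‿homo = fromℤ-neg
      ; 0-homo = refl ; 1-homo = refl }

    _≟ℤ_ : ∀ i j → Maybe (fromℤ i ≡ fromℤ j)
    i ≟ℤ j with i ℤ.≟ j
    ... | yes refl = just refl
    ... | no _     = nothing

  open import Algebra.Solver.Ring ℤ.+-*-rawRing (fromCommutativeRing commutativeRing) homomorphism _≟ℤ_ public

  :0 :1 : ∀ {n} → Polynomial n
  :0 = con (pos 0)
  :1 = con (pos 1)

module Geometry (ℝ : RealField) (em : ExcludedMiddle 0ℓ) where
  open RealField ℝ
  open RealSolver ℝ
  open CommutativeRing commutativeRing using (+-identityˡ; +-comm; *-identityʳ; zeroˡ; zeroʳ; -‿inverseʳ)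
  private module ≤ = IsTotalOrder isTotalOrder
  open ≡-Reasoning

  infixl 6 _-_
  infix  4 _<_

  _-_ : Carrier → Carrier → Carrier
  x - y = x + - y

  _<_ : Carrier → Carrier → Set
  x < y = x ≤ y × x ≢ y

  ≮⇒≥ : ∀ {x y} → ¬ x < y → y ≤ x
  ≮⇒≥ {x} {y} x≮y with ≤.total y x | em {x ≡ y}
  ... | inj₁ y≤x | _       = y≤x
  ... | inj₂ _   | yes x≡y = ≤.reflexive (sym x≡y)
  ... | inj₂ x≤y | no x≢y  = ⊥-elim (x≮y (x≤y , x≢y))

  x-y≡0⇒x≡y : ∀ {x y} → x - y ≡ 0# → x ≡ y
  x-y≡0⇒x≡y {x} {y} x-y≡0 = begin
    x            ≡⟨ solve 2 (λ x y → x := (x :- y) :+ y) refl x y ⟩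
    (x - y) + y  ≡⟨ cong (_+ y) x-y≡0 ⟩
    0# + y       ≡⟨ +-identityˡ y ⟩
    y            ∎

  x+y≡0⇒x≡-y : ∀ {x y} → x + y ≡ 0# → x ≡ - y
  x+y≡0⇒x≡-y {x} {y} x+y≡0 = x-y≡0⇒x≡y (trans (solve 2 (λ x y → x :- :- y := x :+ y) refl x y) x+y≡0)

  x≤y⇒0≤y-x : ∀ {x y} → x ≤ y → 0# ≤ y - x
  x≤y⇒0≤y-x {x} {y} x≤y = subst (_≤ y - x) (-‿inverseʳ x) (+-mono-≤ (- x) x≤y)

  0≤y-x⇒x≤y : ∀ {x y} → 0# ≤ y - x → x ≤ y
  0≤y-x⇒x≤y {x} {y} 0≤y-x =
    subst₂ _≤_ (+-identityˡ x) (solve 2 (λ x y → (y :- x) :+ x := y) refl x y) (+-mono-≤ x 0≤y-x)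

  x<y⇒0<y-x : ∀ {x y} → x < y → 0# < y - x
  x<y⇒0<y-x (x≤y , x≢y) = x≤y⇒0≤y-x x≤y , λ 0≡y-x → x≢y (sym (x-y≡0⇒x≡y (sym 0≡y-x)))

  x≤0⇒0≤-x : ∀ {x} → x ≤ 0# → 0# ≤ - x
  x≤0⇒0≤-x {x} x≤0 = subst (0# ≤_) (+-identityˡ (- x)) (x≤y⇒0≤y-x x≤0)

  0≤x⇒-x≤0 : ∀ {x} → 0# ≤ x → - x ≤ 0#
  0≤x⇒-x≤0 {x} 0≤x = 0≤y-x⇒x≤y (subst (0# ≤_) (solve 1 (λ x → x := :0 :- :- x) refl x) 0≤x)

  x<0⇒0<-x : ∀ {x} → x < 0# → 0# < - x
  x<0⇒0<-x {x} x<0 = subst (0# <_) (+-identityˡ (- x)) (x<y⇒0<y-x x<0)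

  0≤x*x : ∀ x → 0# ≤ x * x
  0≤x*x x with ≤.total 0# x
  ... | inj₁ 0≤x = *-nonneg 0≤x 0≤x
  ... | inj₂ x≤0 = subst (0# ≤_) (solve 1 (λ x → (:- x) :* (:- x) := x :* x) refl x)
                         (*-nonneg (x≤0⇒0≤-x x≤0) (x≤0⇒0≤-x x≤0))

  0≤1 : 0# ≤ 1#
  0≤1 = subst (0# ≤_) (*-identityʳ 1#) (0≤x*x 1#)

  *-nonneg-nonpos : ∀ {x y} → 0# ≤ x → y ≤ 0# → x * y ≤ 0#
  *-nonneg-nonpos {x} {y} 0≤x y≤0 = subst (_≤ 0#) (solve 2 (λ x y → :- (x :* (:- y)) := x :* y) refl x y)
                                          (0≤x⇒-x≤0 (*-nonneg 0≤x (x≤0⇒0≤-x y≤0)))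

  x*y≡0⇒y≡0 : ∀ {x y} → x ≢ 0# → x * y ≡ 0# → y ≡ 0#
  x*y≡0⇒y≡0 {x} {y} x≢0 xy≡0 with inverse x x≢0
  ... | x⁻¹ , xx⁻¹≡1 = begin
    y
      ≡⟨ solve 3 (λ x x⁻¹ y → y := (:1 :- x :* x⁻¹) :* y :+ x⁻¹ :* (x :* y)) refl x x⁻¹ y ⟩
    (1# - x * x⁻¹) * y + x⁻¹ * (x * y)
      ≡⟨ cong₂ (λ a b → (1# - a) * y + x⁻¹ * b) xx⁻¹≡1 xy≡0 ⟩
    (1# - 1#) * y + x⁻¹ * 0#
      ≡⟨ solve 2 (λ x⁻¹ y → (:1 :- :1) :* y :+ x⁻¹ :* :0 := :0) refl x⁻¹ y ⟩
    0# ∎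

  *-pos : ∀ {x y} → 0# < x → 0# < y → 0# < x * y
  *-pos (0≤x , 0≢x) (0≤y , 0≢y) =
    *-nonneg 0≤x 0≤y , λ 0≡xy → 0≢y (sym (x*y≡0⇒y≡0 (≢-sym 0≢x) (sym 0≡xy)))

  +-pos-nonneg : ∀ {x y} → 0# < x → 0# ≤ y → 0# < x + y
  +-pos-nonneg {x} {y} (0≤x , 0≢x) 0≤y = 0≤x+y , λ 0≡x+y → 0≢x (≤.antisym 0≤x (x≤0 0≡x+y))
    where
    0≤x+y : 0# ≤ x + y
    0≤x+y = ≤.trans 0≤y (subst (_≤ x + y) (+-identityˡ y) (+-mono-≤ y 0≤x))
    x≤0 : 0# ≡ x + y → x ≤ 0#
    x≤0 0≡x+y = subst (_≤ 0#) (sym (x+y≡0⇒x≡-y (sym 0≡x+y))) (0≤x⇒-x≤0 0≤y)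

  x+y≡0⇒x≡0 : ∀ {x y} → x ≤ 0# → y ≤ 0# → x + y ≡ 0# → x ≡ 0#
  x+y≡0⇒x≡0 {x} {y} x≤0 y≤0 x+y≡0 =
    ≤.antisym x≤0 (subst (0# ≤_) (sym (x+y≡0⇒x≡-y x+y≡0)) (x≤0⇒0≤-x y≤0))

  positive-combination≢0 : ∀ {α β x y} → 0# < α → 0# ≤ β → 0# < x → 0# ≤ y → α * x + β * y ≢ 0#
  positive-combination≢0 α>0 0≤β x>0 0≤y αx+βy≡0 =
    proj₂ (+-pos-nonneg (*-pos α>0 x>0) (*-nonneg 0≤β 0≤y)) (sym αx+βy≡0)

  nonpositive-combination≡0 : ∀ {α β x y} → 0# < α → 0# < β → x ≤ 0# → y ≤ 0# →
                              α * x + β * y ≡ 0# → x ≡ 0# × y ≡ 0#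
  nonpositive-combination≡0 {α} {β} {x} {y} (0≤α , 0≢α) (0≤β , 0≢β) x≤0 y≤0 αx+βy≡0 =
    x*y≡0⇒y≡0 (0≢α ∘ sym) (x+y≡0⇒x≡0 αx≤0 βy≤0 αx+βy≡0) ,
    x*y≡0⇒y≡0 (0≢β ∘ sym) (x+y≡0⇒x≡0 βy≤0 αx≤0 (trans (+-comm (β * y) (α * x)) αx+βy≡0))
    where
    αx≤0 = *-nonneg-nonpos 0≤α x≤0
    βy≤0 = *-nonneg-nonpos 0≤β y≤0

  interpolation-above : ∀ {t s c x y} → 0# < 1# - t → 0# < t → c < x → c < y → 0# ≤ c → s ≤ 1# →
                        (1# - t) * x + t * y ≢ s * c
  interpolation-above {t} {s} {c} {x} {y} 0<1-t 0<t c<x c<y 0≤c s≤1 on-line = proj₂ 0<excess (sym (begin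
    (1# - t) * (x - c) + t * (y - c) + (1# - s) * c
      ≡⟨ solve 5 (λ t s c x y → (:1 :- t) :* (x :- c) :+ t :* (y :- c) :+ (:1 :- s) :* c
                              := ((:1 :- t) :* x :+ t :* y) :- s :* c) refl t s c x y ⟩
    ((1# - t) * x + t * y) - s * c
      ≡⟨ cong (_- s * c) on-line ⟩
    s * c - s * c
      ≡⟨ -‿inverseʳ (s * c) ⟩
    0# ∎))
    where
    0<excess : 0# < (1# - t) * (x - c) + t * (y - c) + (1# - s) * c
    0<excess = +-pos-nonneg (+-pos-nonneg (*-pos 0<1-t (x<y⇒0<y-x c<x)) (proj₁ (*-pos 0<t (x<y⇒0<y-x c<y))))
                            (*-nonneg (x≤y⇒0≤y-x s≤1) 0≤c)

  interpolation-below : ∀ {t s c x y} → 0# < 1# - t → 0# < t → x < 0# → y < 0# → 0# ≤ c → 0# ≤ s →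
                        (1# - t) * x + t * y ≢ s * c
  interpolation-below {t} {s} {c} {x} {y} 0<1-t 0<t x<0 y<0 0≤c 0≤s on-line = proj₂ 0<deficit (sym (begin
    (1# - t) * (- x) + t * (- y) + s * c
      ≡⟨ solve 5 (λ t s c x y → (:1 :- t) :* (:- x) :+ t :* (:- y) :+ s :* c
                              := s :* c :- ((:1 :- t) :* x :+ t :* y)) refl t s c x y ⟩
    s * c - ((1# - t) * x + t * y)
      ≡⟨ cong (λ e → s * c - e) on-line ⟩
    s * c - s * c
      ≡⟨ -‿inverseʳ (s * c) ⟩
    0# ∎))
    where
    0<deficit : 0# < (1# - t) * (- x) + t * (- y) + s * c
    0<deficit = +-pos-nonneg (+-pos-nonneg (*-pos 0<1-t (x<0⇒0<-x x<0)) (proj₁ (*-pos 0<t (x<0⇒0<-x y<0))))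
                             (*-nonneg 0≤s 0≤c)

  infix  4 _≈_
  infixl 6 _+ᵥ_ _-ᵥ_
  infixr 7 _∙_

  _≈_ : ∀ {d} → Point ℝ d → Point ℝ d → Set
  a ≈ b = _≐_ ℝ a b

  0ᵥ : ∀ {d} → Point ℝ d
  0ᵥ _ = 0#

  _+ᵥ_ _-ᵥ_ : ∀ {d} → Point ℝ d → Point ℝ d → Point ℝ d
  (a +ᵥ b) c = a c + b c
  (a -ᵥ b) c = a c - b c

  _∙_ : ∀ {d} → Carrier → Point ℝ d → Point ℝ d
  (α ∙ a) c = α * a c

  combination≈0⇒≈0 : ∀ {d α β} {a b : Point ℝ d} → α ≢ 0# →
                     α ∙ a +ᵥ β ∙ b ≈ 0ᵥ → b ≈ 0ᵥ → a ≈ 0ᵥ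
  combination≈0⇒≈0 {α = α} {β} {a} {b} α≢0 αa+βb≈0 b≈0 c = x*y≡0⇒y≡0 α≢0 (begin
    α * a c              ≡⟨ solve 3 (λ α β x → α :* x := α :* x :+ β :* :0) refl α β (a c) ⟩
    α * a c + β * 0#     ≡⟨ cong (λ e → α * a c + β * e) (b≈0 c) ⟨
    α * a c + β * b c    ≡⟨ αa+βb≈0 c ⟩
    0#                   ∎)

  LexPositive : ∀ {d} → Pred (Point ℝ d) 0ℓ
  LexPositive {zero}  a = ⊥
  LexPositive {suc d} a = 0# < head a ⊎ (head a ≡ 0# × LexPositive (tail a))

  lexPositive⇒≉0 : ∀ {d} {a : Point ℝ d} → LexPositive a → ¬ a ≈ 0ᵥ
  lexPositive⇒≉0 {suc d} (inj₁ (_ , 0≢a₀)) a≈0 = 0≢a₀ (sym (a≈0 zero))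
  lexPositive⇒≉0 {suc d} (inj₂ (_ , tail>0)) a≈0 = lexPositive⇒≉0 tail>0 (a≈0 ∘ suc)

  lexPositive-combination≉0 : ∀ {d α β} {a b : Point ℝ d} → 0# < α → 0# < β →
                              LexPositive a → LexPositive b → ¬ α ∙ a +ᵥ β ∙ b ≈ 0ᵥ
  lexPositive-combination≉0 {suc d} α>0 β>0 (inj₁ a₀>0) (inj₁ (0≤b₀ , _)) αa+βb≈0 =
    positive-combination≢0 α>0 (proj₁ β>0) a₀>0 0≤b₀ (αa+βb≈0 zero)
  lexPositive-combination≉0 {suc d} α>0 β>0 (inj₁ a₀>0) (inj₂ (b₀≡0 , _)) αa+βb≈0 =
    positive-combination≢0 α>0 (proj₁ β>0) a₀>0 (≤.reflexive (sym b₀≡0)) (αa+βb≈0 zero)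
  lexPositive-combination≉0 {suc d} α>0 β>0 (inj₂ (a₀≡0 , _)) (inj₁ b₀>0) αa+βb≈0 =
    positive-combination≢0 β>0 (proj₁ α>0) b₀>0 (≤.reflexive (sym a₀≡0))
                           (trans (+-comm _ _) (αa+βb≈0 zero))
  lexPositive-combination≉0 {suc d} α>0 β>0 (inj₂ (_ , tail-a>0)) (inj₂ (_ , tail-b>0)) αa+βb≈0 =
    lexPositive-combination≉0 α>0 β>0 tail-a>0 tail-b>0 (αa+βb≈0 ∘ suc)

  ¬lexPositive-combination≈0 : ∀ {d α β} {a b : Point ℝ d} → 0# < α → 0# < β →
                               ¬ LexPositive a → ¬ LexPositive b →
                               α ∙ a +ᵥ β ∙ b ≈ 0ᵥ → a ≈ 0ᵥ × b ≈ 0ᵥ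
  ¬lexPositive-combination≈0 {zero} _ _ _ _ _ = (λ ()) , (λ ())
  ¬lexPositive-combination≈0 {suc d} {a = a} {b} α>0 β>0 a≯0 b≯0 αa+βb≈0 = a≈0 , b≈0
    where
    heads≡0 = nonpositive-combination≡0 α>0 β>0 (≮⇒≥ (a≯0 ∘ inj₁)) (≮⇒≥ (b≯0 ∘ inj₁))
                                        (αa+βb≈0 zero)
    tails≈0 = ¬lexPositive-combination≈0 α>0 β>0 (a≯0 ∘ inj₂ ∘ (proj₁ heads≡0 ,_))
                                         (b≯0 ∘ inj₂ ∘ (proj₂ heads≡0 ,_)) (αa+βb≈0 ∘ suc)
    a≈0 : a ≈ 0ᵥ
    a≈0 zero    = proj₁ heads≡0
    a≈0 (suc c) = proj₁ tails≈0 c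
    b≈0 : b ≈ 0ᵥ
    b≈0 zero    = proj₂ heads≡0
    b≈0 (suc c) = proj₂ tails≈0 c

  OnSegment : ∀ {d} → Point ℝ d → Pred (Point ℝ d) 0ℓ
  OnSegment u a = ∃[ s ] (0# ≤ s × s ≤ 1# × a ≈ s ∙ u)

  -- a ↦ (transversal a, along a) is a linear map ℝᵈ → ℝᵈ × ℝ sending u to (0ᵥ, along u); linearity
  -- is stated only in the form used, for a convex combination of a and b landing on the line ℝu.
  record LineCoordinates {d} (u : Point ℝ d) : Set where
    field
      transversal      : Point ℝ d → Point ℝ d
      along            : Point ℝ d → Carrier
      transversal-line : ∀ {t s a b} → (1# - t) ∙ a +ᵥ t ∙ b ≈ s ∙ u →
                         (1# - t) ∙ transversal a +ᵥ t ∙ transversal b ≈ 0ᵥ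
      along-line       : ∀ {t s a b} → (1# - t) ∙ a +ᵥ t ∙ b ≈ s ∙ u →
                         (1# - t) * along a + t * along b ≡ s * along u
      0≤along-u        : 0# ≤ along u
      onSegment        : ∀ {a} → transversal a ≈ 0ᵥ → 0# ≤ along a → along a ≤ along u → OnSegment u a

  lineCoordinates-zero : ∀ {d} {u : Point ℝ d} → u ≈ 0ᵥ → LineCoordinates u
  lineCoordinates-zero {u = u} u≈0 = record
    { transversal      = id
    ; along            = λ _ → 0#
    ; transversal-line = λ {s = s} meet c → trans (meet c) (trans (cong (s *_) (u≈0 c)) (zeroʳ s))
    ; along-line       = λ {t} {s} _ → solve 2 (λ t s → (:1 :- t) :* :0 :+ t :* :0 := s :* :0) refl t s
    ; 0≤along-u        = ≤.refl
    ; onSegment        = λ a≈0 _ _ → 0# , ≤.refl , 0≤1 , λ c → trans (a≈0 c) (sym (zeroˡ (u c)))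
    }

  lineCoordinates-pivot : ∀ {d} {u : Point ℝ d} k → u k ≢ 0# → LineCoordinates u
  lineCoordinates-pivot {d} {u} k uₖ≢0 = record
    { transversal      = transversal
    ; along            = along
    ; transversal-line = transversal-line
    ; along-line       = along-line
    ; 0≤along-u        = 0≤x*x (u k)
    ; onSegment        = onSegment
    }
    where
    transversal : Point ℝ d → Point ℝ d
    transversal a c = u k * a c - a k * u c

    along : Point ℝ d → Carrier
    along a = a k * u k

    transversal-line : ∀ {t s a b} → (1# - t) ∙ a +ᵥ t ∙ b ≈ s ∙ u →
                       (1# - t) ∙ transversal a +ᵥ t ∙ transversal b ≈ 0ᵥ
    transversal-line {t} {s} {a} {b} meet c = begin
      (1# - t) * transversal a c + t * transversal b c
        ≡⟨ solve 7 (λ t uₖ ac bc aₖ bₖ uc →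
                      (:1 :- t) :* (uₖ :* ac :- aₖ :* uc) :+ t :* (uₖ :* bc :- bₖ :* uc)
                   := uₖ :* ((:1 :- t) :* ac :+ t :* bc) :- ((:1 :- t) :* aₖ :+ t :* bₖ) :* uc)
                 refl t (u k) (a c) (b c) (a k) (b k) (u c) ⟩
      u k * ((1# - t) * a c + t * b c) - ((1# - t) * a k + t * b k) * u c
        ≡⟨ cong₂ (λ x y → u k * x - y * u c) (meet c) (meet k) ⟩
      u k * (s * u c) - (s * u k) * u c
        ≡⟨ solve 3 (λ s uₖ uc → uₖ :* (s :* uc) :- (s :* uₖ) :* uc := :0) refl s (u k) (u c) ⟩
      0# ∎

    along-line : ∀ {t s a b} → (1# - t) ∙ a +ᵥ t ∙ b ≈ s ∙ u →
                 (1# - t) * along a + t * along b ≡ s * along u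
    along-line {t} {s} {a} {b} meet = begin
      (1# - t) * (a k * u k) + t * (b k * u k)
        ≡⟨ solve 4 (λ t aₖ bₖ uₖ → (:1 :- t) :* (aₖ :* uₖ) :+ t :* (bₖ :* uₖ)
                                 := ((:1 :- t) :* aₖ :+ t :* bₖ) :* uₖ) refl t (a k) (b k) (u k) ⟩
      ((1# - t) * a k + t * b k) * u k
        ≡⟨ cong (_* u k) (meet k) ⟩
      (s * u k) * u k
        ≡⟨ solve 2 (λ s uₖ → (s :* uₖ) :* uₖ := s :* (uₖ :* uₖ)) refl s (u k) ⟩
      s * (u k * u k) ∎

    onSegment : ∀ {a} → transversal a ≈ 0ᵥ → 0# ≤ along a → along a ≤ along u → OnSegment u a
    onSegment {a} a∥u 0≤aₖuₖ aₖuₖ≤uₖuₖ with inverse (u k) uₖ≢0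
    ... | w , uₖw≡1 = s , 0≤s , s≤1 , a≈su
      where
      s = a k * w

      s≡aₖuₖw² : s ≡ a k * u k * (w * w)
      s≡aₖuₖw² = begin
        a k * w                  ≡⟨ *-identityʳ (a k * w) ⟨
        a k * w * 1#             ≡⟨ cong (a k * w *_) uₖw≡1 ⟨
        a k * w * (u k * w)      ≡⟨ solve 3 (λ aₖ w uₖ → aₖ :* w :* (uₖ :* w) := aₖ :* uₖ :* (w :* w))
                                            refl (a k) w (u k) ⟩
        a k * u k * (w * w)      ∎

      [uₖuₖ-aₖuₖ]w²≡1-s : (u k * u k - a k * u k) * (w * w) ≡ 1# - s
      [uₖuₖ-aₖuₖ]w²≡1-s = begin
        (u k * u k - a k * u k) * (w * w)
          ≡⟨ solve 3 (λ uₖ aₖ w → (uₖ :* uₖ :- aₖ :* uₖ) :* (w :* w)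
                               := (uₖ :* w) :* (uₖ :* w) :- aₖ :* w :* (uₖ :* w))
                   refl (u k) (a k) w ⟩
        (u k * w) * (u k * w) - s * (u k * w)
          ≡⟨ cong (λ e → e * e - s * e) uₖw≡1 ⟩
        1# * 1# - s * 1#
          ≡⟨ solve 1 (λ s → :1 :* :1 :- s :* :1 := :1 :- s) refl s ⟩
        1# - s ∎

      0≤s : 0# ≤ s
      0≤s = subst (0# ≤_) (sym s≡aₖuₖw²) (*-nonneg 0≤aₖuₖ (0≤x*x w))

      s≤1 : s ≤ 1#
      s≤1 = 0≤y-x⇒x≤y (subst (0# ≤_) [uₖuₖ-aₖuₖ]w²≡1-s
                               (*-nonneg (x≤y⇒0≤y-x aₖuₖ≤uₖuₖ) (0≤x*x w)))

      a≈su : a ≈ s ∙ u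
      a≈su c = begin
        a c
          ≡⟨ solve 5 (λ ac uₖ w aₖ uc →
                        ac := (:1 :- uₖ :* w) :* ac :+ w :* (uₖ :* ac :- aₖ :* uc) :+ aₖ :* w :* uc)
                   refl (a c) (u k) w (a k) (u c) ⟩
        (1# - u k * w) * a c + w * transversal a c + s * u c
          ≡⟨ cong₂ (λ x y → (1# - x) * a c + w * y + s * u c) uₖw≡1 (a∥u c) ⟩
        (1# - 1#) * a c + w * 0# + s * u c
          ≡⟨ solve 4 (λ ac w s uc → (:1 :- :1) :* ac :+ w :* :0 :+ s :* uc := s :* uc)
                   refl (a c) w s (u c) ⟩
        s * u c ∎

  lineCoordinates : ∀ {d} (u : Point ℝ d) → LineCoordinates u
  lineCoordinates {d} u with em {u ≈ 0ᵥ}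
  ... | yes u≈0 = lineCoordinates-zero u≈0
  ... | no u≉0 with Fin.¬∀⟶∃¬ d (λ c → u c ≡ 0#) (λ _ → em) u≉0
  ...   | k , uₖ≢0 = lineCoordinates-pivot k uₖ≢0

  module Separation {d} {p q : Point ℝ d} (F : LineCoordinates (q -ᵥ p)) where
    open LineCoordinates F

    private
      u : Point ℝ d
      u = q -ᵥ p

    Ahead : Pred (Point ℝ d) 0ℓ
    Ahead a = LexPositive (transversal a) ⊎ (transversal a ≈ 0ᵥ × 0# < along a)

    record Crossing (a b : Point ℝ d) : Set where
      field
        t s   : Carrier
        0<1-t : 0# < 1# - t
        0<t   : 0# < t
        0≤s   : 0# ≤ s
        s≤1   : s ≤ 1#
        meet  : (1# - t) ∙ a +ᵥ t ∙ b ≈ s ∙ u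

    ahead-on-line : ∀ {a} → ¬ OnSegment u a → transversal a ≈ 0ᵥ → 0# < along a → along u < along a
    ahead-on-line {a} a∉ a∥u (0≤La , _) with em {along u < along a}
    ... | yes Lu<La = Lu<La
    ... | no Lu≮La  = ⊥-elim (a∉ (onSegment a∥u 0≤La (≮⇒≥ Lu≮La)))

    behind-on-line : ∀ {a} → ¬ OnSegment u a → transversal a ≈ 0ᵥ → ¬ 0# < along a → along a < 0#
    behind-on-line a∉ a∥u La≯0 = ≮⇒≥ La≯0 , λ La≡0 →
      a∉ (onSegment a∥u (≤.reflexive (sym La≡0)) (subst (_≤ along u) (sym La≡0) 0≤along-u))

    ahead-apart : ∀ {a b} → Crossing a b → ¬ OnSegment u a → ¬ OnSegment u b → Ahead a → Ahead b → ⊥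
    ahead-apart {a} {b} X a∉ b∉ = apart
      where
      open Crossing X
      apart : Ahead a → Ahead b → ⊥
      apart (inj₁ τa>0) (inj₁ τb>0) =
        lexPositive-combination≉0 0<1-t 0<t τa>0 τb>0 (transversal-line meet)
      apart (inj₁ τa>0) (inj₂ (τb≈0 , _)) =
        lexPositive⇒≉0 τa>0 (combination≈0⇒≈0 (≢-sym (proj₂ 0<1-t)) (transversal-line meet) τb≈0)
      apart (inj₂ (τa≈0 , _)) (inj₁ τb>0) =
        lexPositive⇒≉0 τb>0 (combination≈0⇒≈0 (≢-sym (proj₂ 0<t))
                                                (λ c → trans (+-comm _ _) (transversal-line meet c)) τa≈0)
      apart (inj₂ (τa≈0 , La>0)) (inj₂ (τb≈0 , Lb>0)) =
        interpolation-above 0<1-t 0<t (ahead-on-line a∉ τa≈0 La>0) (ahead-on-line b∉ τb≈0 Lb>0)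
                            0≤along-u s≤1 (along-line meet)

    behind-apart : ∀ {a b} → Crossing a b → ¬ OnSegment u a → ¬ OnSegment u b → ¬ Ahead a → ¬ Ahead b → ⊥
    behind-apart X a∉ b∉ a≯ b≯ =
      interpolation-below 0<1-t 0<t (behind-on-line a∉ τa≈0 (a≯ ∘ inj₂ ∘ (τa≈0 ,_)))
                                    (behind-on-line b∉ τb≈0 (b≯ ∘ inj₂ ∘ (τb≈0 ,_)))
                          0≤along-u 0≤s (along-line meet)
      where
      open Crossing X
      τ≈0 = ¬lexPositive-combination≈0 0<1-t 0<t (a≯ ∘ inj₁) (b≯ ∘ inj₁) (transversal-line meet)
      τa≈0 = proj₁ τ≈0
      τb≈0 = proj₂ τ≈0

    offSegment : ∀ {x} → ¬ Segment ℝ p q x → ¬ OnSegment u (x -ᵥ p)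
    offSegment {x} x∉pq (s , 0≤s , s≤1 , x-p≈su) = x∉pq (s , 0≤s , s≤1 , λ c → begin
      x c                       ≡⟨ solve 2 (λ x p → x := (x :- p) :+ p) refl (x c) (p c) ⟩
      (x c - p c) + p c         ≡⟨ cong (_+ p c) (x-p≈su c) ⟩
      s * (q c - p c) + p c     ≡⟨ solve 3 (λ s p q → s :* (q :- p) :+ p := (:1 :- s) :* p :+ s :* q)
                                         refl s (p c) (q c) ⟩
      (1# - s) * p c + s * q c  ∎)

    crossing : ∀ {x y z} → ¬ Segment ℝ p q x → ¬ Segment ℝ p q y → Segment ℝ x y z → Segment ℝ p q z →
               Crossing (x -ᵥ p) (y -ᵥ p)
    crossing {x} {y} {z} x∉pq y∉pq (t , 0≤t , t≤1 , z≈xy) (s , 0≤s , s≤1 , z≈pq) = record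
      { t = t ; s = s ; 0<1-t = x≤y⇒0≤y-x t≤1 , 0≢1-t ; 0<t = 0≤t , 0≢t
      ; 0≤s = 0≤s ; s≤1 = s≤1 ; meet = meet }
      where
      at : Carrier → ∀ c → Carrier
      at t′ c = (1# - t′) * x c + t′ * y c

      0≢t : 0# ≢ t
      0≢t 0≡t = x∉pq (s , 0≤s , s≤1 , λ c → begin
        x c       ≡⟨ solve 2 (λ x y → x := (:1 :- :0) :* x :+ :0 :* y) refl (x c) (y c) ⟩
        at 0# c   ≡⟨ cong (λ t′ → at t′ c) 0≡t ⟩
        at t c    ≡⟨ z≈xy c ⟨
        z c       ≡⟨ z≈pq c ⟩
        (1# - s) * p c + s * q c ∎)

      0≢1-t : 0# ≢ 1# - t
      0≢1-t 0≡1-t = y∉pq (s , 0≤s , s≤1 , λ c → begin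
        y c       ≡⟨ solve 2 (λ x y → y := (:1 :- :1) :* x :+ :1 :* y) refl (x c) (y c) ⟩
        at 1# c   ≡⟨ cong (λ t′ → at t′ c) (x-y≡0⇒x≡y (sym 0≡1-t)) ⟩
        at t c    ≡⟨ z≈xy c ⟨
        z c       ≡⟨ z≈pq c ⟩
        (1# - s) * p c + s * q c ∎)

      meet : (1# - t) ∙ (x -ᵥ p) +ᵥ t ∙ (y -ᵥ p) ≈ s ∙ u
      meet c = begin
        (1# - t) * (x c - p c) + t * (y c - p c)
          ≡⟨ solve 4 (λ t x y p → (:1 :- t) :* (x :- p) :+ t :* (y :- p)
                               := (:1 :- t) :* x :+ t :* y :- p) refl t (x c) (y c) (p c) ⟩
        at t c - p c
          ≡⟨ cong (_- p c) (trans (sym (z≈xy c)) (z≈pq c)) ⟩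
        (1# - s) * p c + s * q c - p c
          ≡⟨ solve 3 (λ s p q → (:1 :- s) :* p :+ s :* q :- p := s :* (q :- p)) refl s (p c) (q c) ⟩
        s * (q c - p c) ∎

    avoids : ∀ {A : Pred (Point ℝ d) 0ℓ} →
             (∀ {a b} → Crossing a b → ¬ OnSegment u a → ¬ OnSegment u b → A a → A b → ⊥) →
             AvoidsSegment ℝ p q (A ∘ (_-ᵥ p))
    avoids apart x∈A y∈A x∉pq y∉pq z∈xy z∈pq =
      apart (crossing x∉pq y∉pq z∈xy z∈pq) (offSegment x∉pq) (offSegment y∉pq) x∈A y∈A

open import Data.Nat using (_≤_; _*_; _∸_)

mainTheorem14 : (ℝ : RealField) → ExcludedMiddle 0ℓ →
    (d m : ℕ) → 2 ≤ m → (S : Pred (Point ℝ d) 0ℓ) → PointConvex ℝ m S →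
    (p q : Point ℝ d) → S p → S q →
    PointConvex ℝ (2 * m ∸ 1) (RemoveSeg ℝ S p q)
mainTheorem14 ℝ em d m _ S S-convex p q _ _ =
  removeSeg-pointConvex ℝ m S-convex (λ _ → toSum em) (avoids ahead-apart) (avoids behind-apart)
  where
  open Geometry ℝ em
  open Separation (lineCoordinates (q -ᵥ p))
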